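{- Let $G$ be an undirected connected loopless multigraph on vertex set $\{0,\dots,n\}$, $n\ge1$, in which every pair of distinct vertices is joined by at least one edge. Then $G$ is the only undirected connected loopless multigraph on vertex set $\{0,\dots,n\}$ whose Laplacian lattice equals $L_G$; that is, $N_{Gr}(L_G)=1$.
   Context: The Laplacian matrix of a multigraph is $Q=D-A$ (degree matrix minus adjacency matrix with edge multiplicities), and its Laplacian lattice $L_G\subset\mathbb{R}^{n+1}$ is the set of integer linear combinations of the rows of $Q(G)$. $N_{Gr}(L)$ denotes the number of undirected connected loopless multigraphs on vertex set $\{0,\dots,n\}$ whose Laplacian lattice is $L$. -}

module Defs where

open import Data.Nat using (ℕ; zero; suc; _≥_; _>_)
open import Data.Fin using (Fin; zero; suc)
open import Data.Integer using (ℤ; +_; -_; _*_; _+_)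
open import Data.Product using (Σ; ∃; _×_)
open import Relation.Binary.PropositionalEquality using (_≡_)
open import Relation.Nullary using (¬_; yes; no)
open import Data.Fin using (_≟_)
open import Function.Bundles using (_⇔_)

sumℤ : ∀ {m} → (Fin m → ℤ) → ℤ
sumℤ {zero}  f = + 0
sumℤ {suc m} f = f zero + sumℤ (λ i → f (suc i))

sumℕ : ∀ {m} → (Fin m → ℕ) → ℕ
sumℕ {zero}  f = 0
sumℕ {suc m} f = f zero Data.Nat.+ sumℕ (λ i → f (suc i))

record Multigraph (m : ℕ) : Set where
  field
    mult     : Fin m → Fin m → ℕ
    symm     : ∀ i j → mult i j ≡ mult j i
    loopless : ∀ i → mult i i ≡ 0
open Multigraph public

data Reach {m : ℕ} (G : Multigraph m) : Fin m → Fin m → Set where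
  here : ∀ {i} → Reach G i i
  step : ∀ {i j k} → mult G i j > 0 → Reach G j k → Reach G i k

Connected : ∀ {m} → Multigraph m → Set
Connected G = ∀ i j → Reach G i j

Complete : ∀ {m} → Multigraph m → Set
Complete G = ∀ i j → ¬ (i ≡ j) → mult G i j > 0

degree : ∀ {m} → Multigraph m → Fin m → ℕ
degree G i = sumℕ (λ j → mult G i j)

laplacian : ∀ {m} → Multigraph m → Fin m → Fin m → ℤ
laplacian G i j with i ≟ j
... | yes _ = + degree G i + - (+ mult G i j)
... | no  _ = - (+ mult G i j)

InLattice : ∀ {m} → Multigraph m → (Fin m → ℤ) → Set
InLattice {m} G v = Σ (Fin m → ℤ) λ c → ∀ j → v j ≡ sumℤ (λ i → c i * laplacian G i j)

SameLattice : ∀ {m} → Multigraph m → Multigraph m → Set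
SameLattice {m} G H = ∀ (v : Fin m → ℤ) → InLattice G v ⇔ InLattice H v

-- Write row i of Q(H) as Σ c_k Q(G)_k and row i of Q(G) as Σ d_k Q(H)_k. Entry l of Σ c_k Q(G)_k
-- is the flow Σ_k m_G(k,l) (c_l − c_k), which is ≥ 0 where c is maximal and ≥ deg_G(l) where c
-- has a strict integer maximum. Off the diagonal, row i of Q(G) is negative and row i of Q(H) is
-- nonpositive, so d, and (G being complete) c, have strict maxima at i: a maximum of c elsewhere
-- would make c constant and row i of Q(H) zero, contradicting connectivity. Comparing diagonal
-- entries gives deg_G(i) ≥ deg_H(i) ≥ deg_G(i), and the equality case forces c_k = c_i − 1 for
-- k ≠ i. Then Σ c_k Q(G)_k = Q(G)_i, so H and G have the same i-th row.
module Submission where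

open import Defs
open import Data.Nat using (ℕ; suc; _≥_)
open import Relation.Binary.PropositionalEquality using (_≡_)

import Data.Nat as ℕ
import Data.Nat.Properties as ℕₚ
open import Data.Integer using (ℤ; +_; -_; _+_; _*_; _-_; 0ℤ; 1ℤ; _≤_; _<_; -<+)
import Data.Integer.Properties as ℤₚ
open import Data.Integer.Tactic.RingSolver using (solve-∀)
open import Algebra.Properties.CommutativeSemigroup ℤₚ.+-commutativeSemigroup using (interchange)
open import Algebra.Properties.AbelianGroup ℤₚ.+-0-abelianGroup using (∙-cancelˡ)
open import Data.Fin using (Fin; zero; suc; _≟_)
import Data.Fin.Properties as Finₚ
open import Data.Product using (Σ; ∃; _,_; proj₁; proj₂)
open import Data.Sum using (inj₁; inj₂)
open import Function using (_∘_)
open import Function.Bundles using (Equivalence)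
open import Relation.Binary.PropositionalEquality
  using (refl; sym; trans; cong; cong₂; subst; subst₂; _≢_; module ≡-Reasoning)
open import Relation.Nullary using (¬_; yes; no; contradiction)

sumℤ-cong : ∀ {m} {f g : Fin m → ℤ} → (∀ k → f k ≡ g k) → sumℤ f ≡ sumℤ g
sumℤ-cong {ℕ.zero} f≗g = refl
sumℤ-cong {suc m}  f≗g = cong₂ _+_ (f≗g zero) (sumℤ-cong (f≗g ∘ suc))

sumℤ-+ : ∀ {m} (f g : Fin m → ℤ) → sumℤ (λ k → f k + g k) ≡ sumℤ f + sumℤ g
sumℤ-+ {ℕ.zero} f g = refl
sumℤ-+ {suc m}  f g = trans (cong (_+_ (f zero + g zero)) (sumℤ-+ (f ∘ suc) (g ∘ suc)))
                            (interchange (f zero) (g zero) _ _)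

*-distribˡ-sumℤ : ∀ {m} a (f : Fin m → ℤ) → a * sumℤ f ≡ sumℤ (λ k → a * f k)
*-distribˡ-sumℤ {ℕ.zero} a f = ℤₚ.*-zeroʳ a
*-distribˡ-sumℤ {suc m}  a f = trans (ℤₚ.*-distribˡ-+ a (f zero) _)
                                     (cong (_+_ (a * f zero)) (*-distribˡ-sumℤ a (f ∘ suc)))

sumℤ-zero : ∀ {m} (f : Fin m → ℤ) → (∀ k → f k ≡ 0ℤ) → sumℤ f ≡ 0ℤ
sumℤ-zero {ℕ.zero} f f≗0 = refl
sumℤ-zero {suc m}  f f≗0 = cong₂ _+_ (f≗0 zero) (sumℤ-zero (f ∘ suc) (f≗0 ∘ suc))

sumℤ-delta : ∀ {m} (f : Fin m → ℤ) j → (∀ k → k ≢ j → f k ≡ 0ℤ) → sumℤ f ≡ f j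
sumℤ-delta {suc m} f zero    f≗0 =
  trans (cong (_+_ (f zero)) (sumℤ-zero (f ∘ suc) (λ k → f≗0 (suc k) λ ())))
        (ℤₚ.+-identityʳ (f zero))
sumℤ-delta {suc m} f (suc j) f≗0 =
  trans (cong₂ _+_ (f≗0 zero λ ()) (sumℤ-delta (f ∘ suc) j (λ k k≢j → f≗0 (suc k) (k≢j ∘ Finₚ.suc-injective))))
        (ℤₚ.+-identityˡ (f (suc j)))

+sumℕ : ∀ {m} (f : Fin m → ℕ) → + sumℕ f ≡ sumℤ (λ k → + f k)
+sumℕ {ℕ.zero} f = refl
+sumℕ {suc m}  f = trans (ℤₚ.pos-+ (f zero) _) (cong (_+_ (+ f zero)) (+sumℕ (f ∘ suc)))

f≤sumℕ : ∀ {m} (f : Fin m → ℕ) l → f l ℕ.≤ sumℕ f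
f≤sumℕ f zero    = ℕₚ.m≤m+n (f zero) _
f≤sumℕ f (suc l) = ℕₚ.≤-trans (f≤sumℕ (f ∘ suc) l) (ℕₚ.m≤n+m _ (f zero))

sumℤ-nonneg : ∀ {m} (f : Fin m → ℤ) → (∀ k → 0ℤ ≤ f k) → 0ℤ ≤ sumℤ f
sumℤ-nonneg {ℕ.zero} f f≥0 = ℤₚ.≤-refl
sumℤ-nonneg {suc m}  f f≥0 = ℤₚ.+-mono-≤ (f≥0 zero) (sumℤ-nonneg (f ∘ suc) (f≥0 ∘ suc))

f≤sumℤ : ∀ {m} (f : Fin m → ℤ) → (∀ k → 0ℤ ≤ f k) → ∀ l → f l ≤ sumℤ f
f≤sumℤ f f≥0 zero    = subst (_≤ sumℤ f) (ℤₚ.+-identityʳ (f zero))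
                         (ℤₚ.+-monoʳ-≤ (f zero) (sumℤ-nonneg (f ∘ suc) (f≥0 ∘ suc)))
f≤sumℤ f f≥0 (suc l) = ℤₚ.≤-trans (f≤sumℤ (f ∘ suc) (f≥0 ∘ suc) l)
                         (subst (_≤ sumℤ f) (ℤₚ.+-identityˡ _) (ℤₚ.+-monoˡ-≤ (sumℤ (f ∘ suc)) (f≥0 zero)))

sumℤ-nonneg-≤0⇒zero : ∀ {m} (f : Fin m → ℤ) → (∀ k → 0ℤ ≤ f k) → sumℤ f ≤ 0ℤ → ∀ k → f k ≡ 0ℤ
sumℤ-nonneg-≤0⇒zero f f≥0 sum≤0 k = ℤₚ.≤-antisym (ℤₚ.≤-trans (f≤sumℤ f f≥0 k) sum≤0) (f≥0 k)

IsMax : ∀ {m} → (Fin m → ℤ) → Fin m → Set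
IsMax c j = ∀ k → c k ≤ c j

IsStrictMax : ∀ {m} → (Fin m → ℤ) → Fin m → Set
IsStrictMax c i = ∀ k → k ≢ i → c k < c i

argmax : ∀ {m} (c : Fin (suc m) → ℤ) → Σ (Fin (suc m)) (IsMax c)
argmax {ℕ.zero} c = zero , λ { zero → ℤₚ.≤-refl }
argmax {suc m}  c with argmax (c ∘ suc)
... | j , j-max with c zero ℤₚ.≤? c (suc j)
...   | yes c₀≤cⱼ = suc j , λ { zero → c₀≤cⱼ ; (suc k) → j-max k }
...   | no  c₀≰cⱼ = zero  , λ { zero → ℤₚ.≤-refl
                              ; (suc k) → ℤₚ.≤-trans (j-max k) (ℤₚ.<⇒≤ (ℤₚ.≰⇒> c₀≰cⱼ)) }

¬other-max⇒strict-max : ∀ {m} (c : Fin (suc m) → ℤ) i →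
  (∀ j → j ≢ i → ¬ IsMax c j) → IsStrictMax c i
¬other-max⇒strict-max c i no-other k k≢i with c k ℤₚ.<? c i | argmax c
... | yes cₖ<cᵢ | _ = cₖ<cᵢ
... | no  cₖ≮cᵢ | j , j-max with j ≟ i
...   | yes refl = contradiction (λ l → ℤₚ.≤-trans (j-max l) (ℤₚ.≮⇒≥ cₖ≮cᵢ)) (no-other k k≢i)
...   | no  j≢i  = contradiction j-max (no-other j j≢i)

laplacian-diagonal : ∀ {m} (F : Multigraph m) i → laplacian F i i ≡ + degree F i
laplacian-diagonal F i with i ≟ i
... | yes _   = trans (cong (λ a → + degree F i + - (+ a)) (loopless F i)) (ℤₚ.+-identityʳ _)
... | no  i≢i = contradiction refl i≢i

laplacian-off-diagonal : ∀ {m} (F : Multigraph m) {i j} → i ≢ j → laplacian F i j ≡ - (+ mult F i j)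
laplacian-off-diagonal F {i} {j} i≢j with i ≟ j
... | yes i≡j = contradiction i≡j i≢j
... | no  _   = refl

degree-column : ∀ {m} (F : Multigraph m) l → + degree F l ≡ sumℤ (λ k → + mult F k l)
degree-column F l = trans (+sumℕ (mult F l)) (sumℤ-cong (λ k → cong +_ (symm F l k)))

flow : ∀ {m} → Multigraph m → (Fin m → ℤ) → Fin m → ℤ
flow F c l = sumℤ (λ k → + mult F k l * (c l - c k))

combination≡flow : ∀ {m} (F : Multigraph m) (c : Fin m → ℤ) l →
  sumℤ (λ k → c k * laplacian F k l) ≡ flow F c l
combination≡flow {m} F c l = begin
  sumℤ (λ k → c k * laplacian F k l)
    ≡⟨ sumℤ-cong (λ k → split (c k) (laplacian F k l) (w k)) ⟩
  sumℤ (λ k → diagonal k + outflow k)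
    ≡⟨ sumℤ-+ diagonal outflow ⟩
  sumℤ diagonal + sumℤ outflow
    ≡⟨ cong (_+ sumℤ outflow) (sumℤ-delta diagonal l diagonal-off) ⟩
  c l * (laplacian F l l + w l) + sumℤ outflow
    ≡⟨ cong (λ x → c l * x + sumℤ outflow) diagonal-entry ⟩
  c l * + degree F l + sumℤ outflow
    ≡⟨ cong (λ x → c l * x + sumℤ outflow) (degree-column F l) ⟩
  c l * sumℤ w + sumℤ outflow
    ≡⟨ cong (_+ sumℤ outflow) (*-distribˡ-sumℤ (c l) w) ⟩
  sumℤ (λ k → c l * w k) + sumℤ outflow
    ≡⟨ sumℤ-+ (λ k → c l * w k) outflow ⟨
  sumℤ (λ k → c l * w k + outflow k)
    ≡⟨ sumℤ-cong (λ k → factor (c l) (c k) (w k)) ⟩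
  flow F c l ∎
  where
    open ≡-Reasoning
    w : Fin m → ℤ
    w k = + mult F k l
    outflow : Fin m → ℤ
    outflow k = - (c k * w k)
    diagonal : Fin m → ℤ
    diagonal k = c k * (laplacian F k l + w k)
    diagonal-off : ∀ k → k ≢ l → diagonal k ≡ 0ℤ
    diagonal-off k k≢l = trans (cong (λ x → c k * (x + w k)) (laplacian-off-diagonal F k≢l))
                               (trans (cong (c k *_) (ℤₚ.+-inverseˡ (w k))) (ℤₚ.*-zeroʳ (c k)))
    diagonal-entry : laplacian F l l + w l ≡ + degree F l
    diagonal-entry = trans (cong₂ _+_ (laplacian-diagonal F l) (cong +_ (loopless F l))) (ℤₚ.+-identityʳ _)
    split : ∀ a q x → a * q ≡ a * (q + x) + - (a * x)
    split = solve-∀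
    factor : ∀ a b x → a * x + - (b * x) ≡ x * (a - b)
    factor = solve-∀

row∈lattice : ∀ {m} (F : Multigraph m) i → InLattice F (laplacian F i)
row∈lattice F i = e , λ l → sym (trans (sumℤ-delta _ i (λ k k≢i → cong (_* laplacian F k l) (e-off k k≢i)))
                                       (trans (cong (_* laplacian F i l) e-diagonal) (ℤₚ.*-identityˡ _)))
  where
    e : Fin _ → ℤ
    e k with k ≟ i
    ... | yes _ = 1ℤ
    ... | no  _ = 0ℤ
    e-diagonal : e i ≡ 1ℤ
    e-diagonal with i ≟ i
    ... | yes _   = refl
    ... | no  i≢i = contradiction refl i≢i
    e-off : ∀ k → k ≢ i → e k ≡ 0ℤ
    e-off k k≢i with k ≟ i
    ... | yes k≡i = contradiction k≡i k≢i
    ... | no  _   = refl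

InLattice⇒flow : ∀ {m} (F : Multigraph m) {v : Fin m → ℤ} →
  InLattice F v → ∃ λ c → ∀ l → v l ≡ flow F c l
InLattice⇒flow F (c , v≡combination) = c , λ l → trans (v≡combination l) (combination≡flow F c l)

neg-pos<0 : ∀ {a} → 0 ℕ.< a → - (+ a) < 0ℤ
neg-pos<0 {suc a} _ = -<+

+*-nonneg : ∀ a {x} → 0ℤ ≤ x → 0ℤ ≤ + a * x
+*-nonneg a {x} 0≤x = subst (_≤ + a * x) (ℤₚ.*-zeroʳ (+ a)) (ℤₚ.*-monoˡ-≤-nonNeg (+ a) 0≤x)

+*≡0⇒≡0 : ∀ {a x} → 0 ℕ.< a → + a * x ≡ 0ℤ → x ≡ 0ℤ
+*≡0⇒≡0 {a} 0<a ax≡0 with ℤₚ.i*j≡0⇒i≡0∨j≡0 (+ a) ax≡0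
... | inj₁ a≡0 = contradiction (ℤₚ.+-injective a≡0) (ℕₚ.n>0⇒n≢0 0<a)
... | inj₂ x≡0 = x≡0

*[i-j]≡0 : ∀ a {i j} → i ≡ j → a * (i - j) ≡ 0ℤ
*[i-j]≡0 a i≡j = trans (cong (a *_) (ℤₚ.i≡j⇒i-j≡0 i≡j)) (ℤₚ.*-zeroʳ a)

flow-terms-nonneg-at-max : ∀ {m} (F : Multigraph m) c {l} → IsMax c l →
  ∀ k → 0ℤ ≤ + mult F k l * (c l - c k)
flow-terms-nonneg-at-max F c {l} l-max k = +*-nonneg (mult F k l) (ℤₚ.i≤j⇒0≤j-i (l-max k))

flow-nonneg-at-max : ∀ {m} (F : Multigraph m) c {l} → IsMax c l → 0ℤ ≤ flow F c l
flow-nonneg-at-max F c l-max = sumℤ-nonneg _ (flow-terms-nonneg-at-max F c l-max)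

flow-constant : ∀ {m} (F : Multigraph m) c {a} → (∀ k → c k ≡ a) → ∀ l → flow F c l ≡ 0ℤ
flow-constant F c c≡a l = sumℤ-zero _ λ k → *[i-j]≡0 (+ mult F k l) (trans (c≡a l) (sym (c≡a k)))

flow≤0-at-max⇒constant : ∀ {m} (F : Multigraph m) c {l} → Complete F → IsMax c l →
  flow F c l ≤ 0ℤ → ∀ k → c k ≡ c l
flow≤0-at-max⇒constant F c {l} complete l-max flow≤0 k with k ≟ l
... | yes refl = refl
... | no  k≢l  = sym (ℤₚ.i-j≡0⇒i≡j _ _ (+*≡0⇒≡0 (complete k l k≢l)
                   (sumℤ-nonneg-≤0⇒zero _ (flow-terms-nonneg-at-max F c l-max) flow≤0 k)))

excess : ∀ {m} → Multigraph m → (Fin m → ℤ) → Fin m → ℤ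
excess F c l = sumℤ (λ k → + mult F k l * (c l - c k - 1ℤ))

flow≡degree+excess : ∀ {m} (F : Multigraph m) c l → flow F c l ≡ + degree F l + excess F c l
flow≡degree+excess F c l =
  trans (sumℤ-cong (λ k → peel (+ mult F k l) (c l - c k)))
        (trans (sumℤ-+ (λ k → + mult F k l) (λ k → + mult F k l * (c l - c k - 1ℤ)))
               (cong (_+ excess F c l) (sym (degree-column F l))))
  where
    peel : ∀ a x → a * x ≡ a + a * (x - 1ℤ)
    peel = solve-∀

-- At k = l the factor c l − c k − 1 is −1; looplessness kills that term.
excess-terms-nonneg-at-strict-max : ∀ {m} (F : Multigraph m) c {l} → IsStrictMax c l →
  ∀ k → 0ℤ ≤ + mult F k l * (c l - c k - 1ℤ)
excess-terms-nonneg-at-strict-max F c {l} l-strict k with k ≟ l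
... | yes refl = ℤₚ.≤-reflexive (sym (cong (_* (c k - c k - 1ℤ)) (cong +_ (loopless F k))))
... | no  k≢l  = +*-nonneg (mult F k l)
                   (subst (0ℤ ≤_) (regroup (c l) (c k)) (ℤₚ.i≤j⇒0≤j-i (ℤₚ.i<j⇒suc[i]≤j (l-strict k k≢l))))
  where
    regroup : ∀ a b → a - (1ℤ + b) ≡ a - b - 1ℤ
    regroup = solve-∀

degree≤flow-at-strict-max : ∀ {m} (F : Multigraph m) c {l} → IsStrictMax c l → + degree F l ≤ flow F c l
degree≤flow-at-strict-max F c {l} l-strict =
  subst₂ _≤_ (ℤₚ.+-identityʳ _) (sym (flow≡degree+excess F c l))
    (ℤₚ.+-monoʳ-≤ (+ degree F l) (sumℤ-nonneg _ (excess-terms-nonneg-at-strict-max F c l-strict)))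

flow≡degree⇒drop-by-one : ∀ {m} (F : Multigraph m) c {l} → Complete F → IsStrictMax c l →
  flow F c l ≡ + degree F l → ∀ k → k ≢ l → c k ≡ c l - 1ℤ
flow≡degree⇒drop-by-one F c {l} complete l-strict flow≡degree k k≢l =
  sym (ℤₚ.i-j≡0⇒i≡j _ _ (trans (regroup (c l) (c k)) (+*≡0⇒≡0 (complete k l k≢l)
    (sumℤ-nonneg-≤0⇒zero _ (excess-terms-nonneg-at-strict-max F c l-strict) (ℤₚ.≤-reflexive excess≡0) k))))
  where
    excess≡0 : excess F c l ≡ 0ℤ
    excess≡0 = ∙-cancelˡ (+ degree F l) _ _
                 (trans (sym (flow≡degree+excess F c l)) (trans flow≡degree (sym (ℤₚ.+-identityʳ _))))
    regroup : ∀ a b → a - 1ℤ - b ≡ a - b - 1ℤ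
    regroup = solve-∀

flow-drop-by-one : ∀ {m} (F : Multigraph m) c {i j} → (∀ k → k ≢ i → c k ≡ c i - 1ℤ) →
  j ≢ i → flow F c j ≡ - (+ mult F i j)
flow-drop-by-one F c {i} {j} drop j≢i = begin
  flow F c j                       ≡⟨ sumℤ-delta _ i (λ k k≢i → *[i-j]≡0 (+ mult F k j) (trans (drop j j≢i) (sym (drop k k≢i)))) ⟩
  + mult F i j * (c j - c i)       ≡⟨ cong (λ x → + mult F i j * (x - c i)) (drop j j≢i) ⟩
  + mult F i j * (c i - 1ℤ - c i)  ≡⟨ step-down (+ mult F i j) (c i) ⟩
  - (+ mult F i j)                 ∎
  where
    open ≡-Reasoning
    step-down : ∀ a x → a * (x - 1ℤ - x) ≡ - a
    step-down = solve-∀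

flow-negative⇒strict-max : ∀ {m} (F : Multigraph (suc m)) c i →
  (∀ l → l ≢ i → flow F c l < 0ℤ) → IsStrictMax c i
flow-negative⇒strict-max F c i negative = ¬other-max⇒strict-max c i λ j j≢i j-max →
  ℤₚ.<⇒≱ (negative j j≢i) (flow-nonneg-at-max F c j-max)

flow-nonpositive⇒strict-max : ∀ {m} (F : Multigraph (suc m)) c i → Complete F →
  (∀ l → l ≢ i → flow F c l ≤ 0ℤ) → flow F c i ≢ 0ℤ → IsStrictMax c i
flow-nonpositive⇒strict-max F c i complete nonpositive flowᵢ≢0 = ¬other-max⇒strict-max c i λ j j≢i j-max →
  flowᵢ≢0 (flow-constant F c (flow≤0-at-max⇒constant F c complete j-max (nonpositive j j≢i)) i)

reach-other⇒degree-pos : ∀ {m} (F : Multigraph m) {i j} → Reach F i j → i ≢ j → 0 ℕ.< degree F i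
reach-other⇒degree-pos F here                   i≢i = contradiction refl i≢i
reach-other⇒degree-pos F (step {j = k} 0<mᵢₖ _) _   = ℕₚ.<-≤-trans 0<mᵢₖ (f≤sumℕ (mult F _) k)

connected⇒degree-pos : ∀ {n} → n ≥ 1 → (F : Multigraph (suc n)) → Connected F → ∀ i → 0 ℕ.< degree F i
connected⇒degree-pos {suc n} _ F connected zero    = reach-other⇒degree-pos F (connected zero (suc zero)) λ ()
connected⇒degree-pos {suc n} _ F connected (suc i) = reach-other⇒degree-pos F (connected (suc i) zero) λ ()

row-coefficients-drop-by-one : ∀ {m} {G H : Multigraph (suc m)} {i} c d → Complete G → 0 ℕ.< degree H i →
  (∀ l → laplacian H i l ≡ flow G c l) → (∀ l → laplacian G i l ≡ flow H d l) →
  ∀ k → k ≢ i → c k ≡ c i - 1ℤ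
row-coefficients-drop-by-one {G = G} {H} {i} c d complete 0<degHᵢ Hᵢ≡flow Gᵢ≡flow =
  flow≡degree⇒drop-by-one G c complete c-strict
    (ℤₚ.≤-antisym flow≤degree (degree≤flow-at-strict-max G c c-strict))
  where
    Hᵢᵢ : + degree H i ≡ flow G c i
    Hᵢᵢ = trans (sym (laplacian-diagonal H i)) (Hᵢ≡flow i)
    Gᵢᵢ : + degree G i ≡ flow H d i
    Gᵢᵢ = trans (sym (laplacian-diagonal G i)) (Gᵢ≡flow i)
    Gᵢₗ : ∀ l → l ≢ i → - (+ mult G i l) ≡ flow H d l
    Gᵢₗ l l≢i = trans (sym (laplacian-off-diagonal G (l≢i ∘ sym))) (Gᵢ≡flow l)
    Hᵢₗ : ∀ l → l ≢ i → - (+ mult H i l) ≡ flow G c l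
    Hᵢₗ l l≢i = trans (sym (laplacian-off-diagonal H (l≢i ∘ sym))) (Hᵢ≡flow l)
    d-strict : IsStrictMax d i
    d-strict = flow-negative⇒strict-max H d i λ l l≢i →
      subst (_< 0ℤ) (Gᵢₗ l l≢i) (neg-pos<0 (complete i l (l≢i ∘ sym)))
    c-strict : IsStrictMax c i
    c-strict = flow-nonpositive⇒strict-max G c i complete
      (λ l l≢i → subst (_≤ 0ℤ) (Hᵢₗ l l≢i) ℤₚ.neg-≤-pos)
      (λ flow≡0 → ℕₚ.n>0⇒n≢0 0<degHᵢ (ℤₚ.+-injective (trans Hᵢᵢ flow≡0)))
    flow≤degree : flow G c i ≤ + degree G i
    flow≤degree = subst₂ _≤_ Hᵢᵢ (sym Gᵢᵢ) (degree≤flow-at-strict-max H d d-strict)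

mainTheorem4 : (n : ℕ) → n ≥ 1 → (G : Multigraph (suc n)) → Connected G → Complete G →
    (H : Multigraph (suc n)) → Connected H → SameLattice G H →
    ∀ i j → mult H i j ≡ mult G i j
mainTheorem4 n n≥1 G _ complete H connected same i j with i ≟ j
... | yes refl = trans (loopless H i) (sym (loopless G i))
... | no  i≢j = ℤₚ.+-injective (ℤₚ.neg-injective (begin
  - (+ mult H i j)  ≡⟨ laplacian-off-diagonal H i≢j ⟨
  laplacian H i j   ≡⟨ Hᵢ≡flow j ⟩
  flow G c j        ≡⟨ flow-drop-by-one G c c-drops (i≢j ∘ sym) ⟩
  - (+ mult G i j)  ∎))
  where
    open ≡-Reasoning
    c-representation : ∃ λ c → ∀ l → laplacian H i l ≡ flow G c l
    c-representation = InLattice⇒flow G (Equivalence.from (same (laplacian H i)) (row∈lattice H i))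
    d-representation : ∃ λ d → ∀ l → laplacian G i l ≡ flow H d l
    d-representation = InLattice⇒flow H (Equivalence.to (same (laplacian G i)) (row∈lattice G i))
    c : Fin (suc n) → ℤ
    c = proj₁ c-representation
    Hᵢ≡flow : ∀ l → laplacian H i l ≡ flow G c l
    Hᵢ≡flow = proj₂ c-representation
    c-drops : ∀ k → k ≢ i → c k ≡ c i - 1ℤ
    c-drops = row-coefficients-drop-by-one c (proj₁ d-representation) complete
                (connected⇒degree-pos n≥1 H connected i) Hᵢ≡flow (proj₂ d-representation)
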